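{- Let $\kappa:\mathbb N\to\mathbb N$ be defined by $$\kappa(n)=\begin{cases}\lfloor\varphi n+1\rfloor,& n\in R_{2,0},\\ \lfloor\varphi n-1\rfloor,& n\in R_{1,0},\\ \lfloor(\varphi-1)n+1\rfloor,& n\in R_{1,1}.\end{cases}$$ If $n\in R_{1,0}$, then $\kappa(n)\in R_{1,0}$ and $\kappa^3(n)=\kappa^2(n)+\kappa(n)-2$.
   Context: Let $\varphi=\frac{1+\sqrt5}{2}$ and $\mathbb N=\{1,2,3,\dots\}$; $a(n)=\lfloor n\varphi\rfloor$. $F$ is the Fibonacci sequence, $F(0)=0$, $F(1)=F(2)=1$, $F(n)=F(n-1)+F(n-2)$. For $i\in\mathbb Z^{\geq0}$, $j\in\mathbb Z$, let $f_{i,j}(n)=F(i+1)a(n)+F(i)n-j$ ($n\in\mathbb N$) and $R_{i,j}=\{f_{i,j}(n)\mid n\in\mathbb N\}$; the sets $R_{1,0},R_{1,1},R_{2,0}$ partition $\mathbb N$. Powers denote iterated composition. -}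

module Defs where

open import Data.Nat using (ℕ; zero; suc; _+_; _*_; _∸_; _≤_; _<_; _≤ᵇ_; _<ᵇ_)
open import Data.Bool using (Bool; true; false; _∨_; if_then_else_)
open import Data.Integer as ℤ using (ℤ; +_)
open import Data.Product using (∃; _×_)
open import Relation.Binary.PropositionalEquality using (_≡_)

F : ℕ → ℕ
F zero = 0
F (suc zero) = 1
F (suc (suc n)) = F (suc n) + F n

-- belowφ n m = true  iff  m ≤ n·φ  (exact test, φ = (1+√5)/2):
--   m ≤ nφ  ⇔  2m - n ≤ n√5  ⇔  2m ≤ n  or  (2m-n)² ≤ 5n²
belowφ : ℕ → ℕ → Bool
belowφ n m = (2 * m ≤ᵇ n) ∨ (((2 * m ∸ n) * (2 * m ∸ n)) ≤ᵇ (5 * (n * n)))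

countBelow : ℕ → ℕ → ℕ
countBelow n zero = 0
countBelow n (suc k) = (if belowφ n (suc k) then 1 else 0) + countBelow n k

-- a n = ⌊ n φ ⌋ ; since 0 ≤ nφ < 2n and the test is monotone in m,
-- ⌊nφ⌋ = #{ m ∈ {1,…,2n} : m ≤ nφ }
a : ℕ → ℕ
a n = countBelow n (2 * n)

f : ℕ → ℤ → ℕ → ℤ
f i j n = (+ (F (suc i) * a n + F i * n)) ℤ.- j

R : ℕ → ℤ → ℕ → Set
R i j n = ∃ λ m → 1 ≤ m × f i j m ≡ + n

iter : ℕ → (ℕ → ℕ) → ℕ → ℕ
iter zero g x = x
iter (suc k) g x = g (iter k g x)

-- κ is specified (on ℕ = {1,2,…}) by the three defining clauses; since
-- R_{2,0}, R_{1,0}, R_{1,1} partition ℕ this determines κ uniquely there.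
--   ⌊φn+1⌋ = a n + 1,  ⌊φn−1⌋ = a n − 1,  ⌊(φ−1)n+1⌋ = a n − n + 1
IsKappa : (ℕ → ℕ) → Set
IsKappa κ =
  (∀ n → 1 ≤ n → R 2 (+ 0) n → κ n ≡ a n + 1) ×
  (∀ n → 1 ≤ n → R 1 (+ 0) n → κ n ≡ a n ∸ 1) ×
  (∀ n → 1 ≤ n → R 1 (+ 1) n → κ n ≡ a n ∸ n + 1)

-- Write Q(j, n) = j² − jn − n²; then j ≤ nφ iff Q(j, n) ≤ 0, so a(n) is the largest j
-- with Q(j, n) ≤ 0, and Q(j, n) ≠ 0 for n ≥ 1 by infinite descent. The substitution
-- (j, n) ↦ (j + n, j) negates Q, which for k = a(m) gives a(k) = k + m − 1 and
-- a(k + m) = 2k + m. So κ sends a(m) + m ∈ R_{1,0} to a(k) + k: along R_{1,0}, κ is a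
-- acting on the index m, and the recurrence is a(a x) + 1 = a x + x for x = a m, a (a m).

module Submission where

open import Defs
open import Data.Nat using (ℕ; zero; suc; _+_; _*_; _∸_; _≤_; _<_; _≤?_; z≤n; s≤s; s≤s⁻¹)
open import Data.Nat.Properties
open import Data.Nat.Induction using (<-rec)
open import Data.Nat.Tactic.RingSolver using (solve-∀)
open import Data.Integer using (+_)
import Data.Integer.Properties as ℤ
open import Data.Bool using (true; false; T)
open import Data.Bool.Properties using (T-∨)
open import Data.Product using (_×_; _,_; proj₁; proj₂)
open import Data.Sum using (inj₁; inj₂; [_,_])
open import Data.Unit using (tt)
open import Data.Empty using (⊥-elim)
open import Function.Bundles using (_⇔_; mk⇔; Equivalence)
open import Relation.Nullary using (¬_; yes; no; contradiction)
open import Relation.Binary.Definitions using (tri<; tri≈; tri>)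
open import Relation.Binary.PropositionalEquality hiding ([_])
open Equivalence using (to; from)

-- Linear arithmetic by certificate: the identity, checked by the ring solver, exhibits
-- Y − X as (B − A) + E.
≤-by-certificate : ∀ {A B} X Y E → A ≤ B → X + B + E ≡ Y + A → X ≤ Y
≤-by-certificate {A} {B} X Y E A≤B eq = +-cancelʳ-≤ B X Y (begin
  X + B      ≤⟨ m≤m+n (X + B) E ⟩
  X + B + E  ≡⟨ eq ⟩
  Y + A      ≤⟨ +-monoʳ-≤ Y A≤B ⟩
  Y + B      ∎)
  where open ≤-Reasoning

≤⇔≤-of-+≡+ : ∀ {a b c d} → a + c ≡ b + d → a ≤ b ⇔ d ≤ c
≤⇔≤-of-+≡+ {a} {b} {c} {d} eq = mk⇔
  (λ a≤b → +-cancelˡ-≤ b d c (subst (_≤ b + c) eq (+-monoˡ-≤ c a≤b)))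
  (λ d≤c → +-cancelʳ-≤ c a b (subst (_≤ b + c) (sym eq) (+-monoʳ-≤ b d≤c)))

-- Below n j ⇔ j ≤ nφ and Above n j ⇔ nφ ≤ j, since φ is the positive root of x² = x + 1.
Below Above : ℕ → ℕ → Set
Below n j = j * j ≤ j * n + n * n
Above n j = j * n + n * n ≤ j * j

Below-of-≤ : ∀ {n j} → j ≤ n → Below n j
Below-of-≤ {n} {j} j≤n = ≤-trans (*-monoʳ-≤ j j≤n) (m≤m+n (j * n) (n * n))

Below⇔∸ : ∀ {n j} → Below n j ⇔ j * (j ∸ n) ≤ n * n
Below⇔∸ {n} {j} = mk⇔
  (λ b → subst (_≤ n * n) (sym (*-distribˡ-∸ j j n)) (m≤n+o⇒m∸n≤o (j * j) (j * n) b))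
  (λ le → ≤-trans (m≤n+m∸n (j * j) (j * n))
                  (+-monoʳ-≤ (j * n) (subst (_≤ n * n) (*-distribˡ-∸ j j n) le)))

Below-downward : ∀ {n j t} → j ≤ t → Below n t → Below n j
Below-downward {n} {j} {t} j≤t bt =
  from (Below⇔∸ {n} {j}) (≤-trans (*-mono-≤ j≤t (∸-monoˡ-≤ n j≤t)) (to (Below⇔∸ {n} {t}) bt))

¬Below-double : ∀ {n} → 1 ≤ n → ¬ Below n (2 * n)
¬Below-double {suc n} _ = <⇒≱ (≤-by-certificate _ _ 0 (s≤s z≤n) (identity (suc n)))
  where
  identity : ∀ n → suc (2 * n * n + n * n) + n * n + 0 ≡ (2 * n) * (2 * n) + 1
  identity = solve-∀

Below⇒<2* : ∀ {n j} → 1 ≤ n → Below n j → j < 2 * n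
Below⇒<2* 1≤n b = ≰⇒> (λ 2n≤j → ¬Below-double 1≤n (Below-downward 2n≤j b))

-- Q(j + n, j) = −Q(j, n) for the form Q(j, n) = j² − jn − n².
golden-swap : ∀ j n → (j + n) * (j + n) + j * j ≡ ((j + n) * j + j * j) + (j * n + n * n)
golden-swap = solve-∀

Below-swap : ∀ j n → Below j (j + n) ⇔ Above n j
Below-swap j n = ≤⇔≤-of-+≡+ (golden-swap j n)

Above-swap : ∀ j n → Above j (j + n) ⇔ Below n j
Above-swap j n = ≤⇔≤-of-+≡+ (sym (golden-swap j n))

solution⇒< : ∀ {n j} → 1 ≤ n → j * j ≡ j * n + n * n → n < j
solution⇒< {suc n} {j} _ eq = ≰⇒> λ j≤n → <-irrefl eq (begin-strict
  j * j                     ≤⟨ *-monoʳ-≤ j j≤n ⟩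
  j * suc n                 <⟨ m<m+n (j * suc n) (s≤s z≤n) ⟩
  j * suc n + suc n * suc n ∎)
  where open ≤-Reasoning

-- Descent: a solution (n + e, n) of j² = jn + n² yields the smaller solution (n, e).
golden-irrational : ∀ n → 1 ≤ n → ∀ j → j * j ≢ j * n + n * n
golden-irrational = <-rec (λ n → 1 ≤ n → ∀ j → j * j ≢ j * n + n * n) descend
  where
  descend : ∀ n → (∀ {e} → e < n → 1 ≤ e → ∀ j → j * j ≢ j * e + e * e) →
            1 ≤ n → ∀ j → j * j ≢ j * n + n * n
  descend n smaller 1≤n j eq with m≤n⇒∃[o]m+o≡n {n} {j} (<⇒≤ (solution⇒< 1≤n eq))
  ... | zero , refl = <-irrefl (sym (+-identityʳ n)) (solution⇒< 1≤n eq)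
  ... | suc e , refl = smaller (solution⇒< (s≤s z≤n) eq′) (s≤s z≤n) n eq′
    where
    eq′ : n * n ≡ n * suc e + suc e * suc e
    eq′ = +-cancelˡ-≡ ((n + suc e) * n + n * n) _ _
            (trans (cong (_+ n * n) (sym eq)) (golden-swap n (suc e)))

Below⇒¬Above : ∀ {n j} → 1 ≤ n → Below n j → ¬ Above n j
Below⇒¬Above {n} {j} 1≤n b ab = golden-irrational n 1≤n j (≤-antisym b ab)

Above-of-¬Below-suc : ∀ {n j} → j < 2 * suc n → ¬ Below (suc n) (suc j) → Above n j
Above-of-¬Below-suc {n} {j} j<2n+2 nb =
  ≤-by-certificate _ _ (suc n) (+-mono-≤ (≰⇒> nb) j<2n+2) (identity n j)
  where
  identity : ∀ n j → j * n + n * n + (suc j * suc j + 2 * suc n) + suc n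
               ≡ j * j + (suc (suc j * suc n + suc n * suc n) + suc j)
  identity = solve-∀

¬Below-shift : ∀ {n j} → ¬ Below n (suc j) → ¬ Below (j + n) (suc ((j + n) + j))
¬Below-shift {n} {j} nb = <⇒≱ (≤-by-certificate _ _ (j + 2 * n) (≰⇒> nb) (identity n j))
  where
  identity : ∀ n j → let s = suc ((j + n) + j) in
    suc (s * (j + n) + (j + n) * (j + n)) + suc j * suc j + (j + 2 * n)
      ≡ s * s + suc (suc j * n + n * n)
  identity = solve-∀

Scaled : ℕ → ℕ → Set
Scaled n M = M * M ≤ 2 * (M * n) + 4 * (n * n)

Below⇔Scaled : ∀ n m → Below n m ⇔ Scaled n (2 * m)
Below⇔Scaled n m = mk⇔
  (λ b → subst₂ _≤_ (square m) (linear m n) (*-monoʳ-≤ 4 b))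
  (λ s → *-cancelˡ-≤ 4 (subst₂ _≤_ (sym (square m)) (sym (linear m n)) s))
  where
  square : ∀ m → 4 * (m * m) ≡ (2 * m) * (2 * m)
  square = solve-∀
  linear : ∀ m n → 4 * (m * n + n * n) ≡ 2 * ((2 * m) * n) + 4 * (n * n)
  linear = solve-∀

Scaled⇔square : ∀ {n M} → n ≤ M → Scaled n M ⇔ (M ∸ n) * (M ∸ n) ≤ 5 * (n * n)
Scaled⇔square {n} {M} n≤M with m≤n⇒∃[o]m+o≡n {n} {M} n≤M
... | d , refl = subst (λ e → Scaled n (n + d) ⇔ e * e ≤ 5 * (n * n)) (sym (m+n∸m≡n n d))
                   (≤⇔≤-of-+≡+ (identity n d))
  where
  identity : ∀ n d → (n + d) * (n + d) + 5 * (n * n) ≡ (2 * ((n + d) * n) + 4 * (n * n)) + d * d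
  identity = solve-∀

T-belowφ⇔Below : ∀ n m → T (belowφ n m) ⇔ Below n m
T-belowφ⇔Below n m with 2 * m ≤? n
... | yes 2m≤n = mk⇔ (λ _ → Below-of-≤ (≤-trans (m≤m+n m (m + 0)) 2m≤n))
                     (λ _ → from T-∨ (inj₁ (≤⇒≤ᵇ 2m≤n)))
... | no 2m≰n = mk⇔
  (λ t → [ (λ t₁ → contradiction (≤ᵇ⇒≤ _ _ t₁) 2m≰n)
         , (λ t₂ → from (Below⇔Scaled n m) (from (Scaled⇔square n≤2m) (≤ᵇ⇒≤ _ _ t₂))) ] (to T-∨ t))
  (λ b → from T-∨ (inj₂ (≤⇒≤ᵇ (to (Scaled⇔square n≤2m) (to (Below⇔Scaled n m) b)))))
  where
  n≤2m : n ≤ 2 * m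
  n≤2m = <⇒≤ (≰⇒> 2m≰n)

countBelow-≤ : ∀ n K → countBelow n K ≤ K
countBelow-≤ n zero = z≤n
countBelow-≤ n (suc K) with belowφ n (suc K)
... | true = s≤s (countBelow-≤ n K)
... | false = m≤n⇒m≤1+n (countBelow-≤ n K)

countBelow-spec : ∀ n K {j} → j ≤ K → (j ≤ countBelow n K ⇔ Below n j)
countBelow-spec n zero z≤n = mk⇔ (λ _ → z≤n) (λ _ → z≤n)
countBelow-spec n (suc K) {j} j≤K+1 with belowφ n (suc K) in test
... | true = mk⇔ (λ _ → Below-downward j≤K+1 below) (λ _ → ≤-trans j≤K+1 (s≤s K≤count))
  where
  below : Below n (suc K)
  below = to (T-belowφ⇔Below n (suc K)) (subst T (sym test) tt)
  K≤count : K ≤ countBelow n K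
  K≤count = from (countBelow-spec n K ≤-refl) (Below-downward (n≤1+n K) below)
... | false with m≤n⇒m<n∨m≡n j≤K+1
...   | inj₁ j<K+1 = countBelow-spec n K (s≤s⁻¹ j<K+1)
...   | inj₂ refl = mk⇔
  (λ K<count → contradiction (≤-trans K<count (countBelow-≤ n K)) (<-irrefl refl))
  (λ b → ⊥-elim (subst T test (from (T-belowφ⇔Below n (suc K)) b)))

a-spec : ∀ {n} → 1 ≤ n → Below n (a n) × ¬ Below n (suc (a n))
a-spec {n} 1≤n =
  to (countBelow-spec n (2 * n) (<⇒≤ a<2n)) ≤-refl ,
  λ b → <-irrefl refl (from (countBelow-spec n (2 * n) a<2n) b)
  where
  a<2n : a n < 2 * n
  a<2n = ≰⇒> (λ 2n≤a → ¬Below-double 1≤n (to (countBelow-spec n (2 * n) ≤-refl) 2n≤a))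

a-unique : ∀ {n k} → 1 ≤ n → Below n k → ¬ Below n (suc k) → a n ≡ k
a-unique {n} {k} 1≤n below above with a-spec 1≤n | <-cmp (a n) k
... | _ , above′ | tri< a<k _ _ = contradiction (Below-downward a<k below) above′
... | _ , _      | tri≈ _ a≡k _ = a≡k
... | below′ , _ | tri> _ _ k<a = contradiction (Below-downward k<a below′) above

a-pos : ∀ {m} → 1 ≤ m → 1 ≤ a m
a-pos {m} 1≤m =
  ≰⇒> (λ a≤0 → proj₂ (a-spec 1≤m) (Below-downward {m} (s≤s a≤0) (Below-of-≤ 1≤m)))

a∘a : ∀ {m} → 1 ≤ m → suc (a (a m)) ≡ a m + m
a∘a {suc m} 1≤m = trans (cong suc (a-unique (a-pos 1≤m) below-k+m above-k+m+1)) (sym (+-suc k m))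
  where
  k : ℕ
  k = a (suc m)
  below-k+m : Below k (k + m)
  below-k+m = from (Below-swap k m) (Above-of-¬Below-suc {m} {k}
    (Below⇒<2* {suc m} {k} 1≤m (proj₁ (a-spec 1≤m))) (proj₂ (a-spec 1≤m)))
  above-k+m+1 : ¬ Below k (suc (k + m))
  above-k+m+1 b = Below⇒¬Above {suc m} {k} 1≤m (proj₁ (a-spec 1≤m))
    (to (Below-swap k (suc m)) (subst (Below k) (sym (+-suc k m)) b))

a-golden-sum : ∀ {m} → 1 ≤ m → a (a m + m) ≡ (a m + m) + a m
a-golden-sum {m} 1≤m = a-unique (≤-trans 1≤m (m≤n+m m (a m)))
  (from (Below-swap (a m + m) (a m)) (from (Above-swap (a m) m) (proj₁ (a-spec 1≤m))))
  (¬Below-shift {m} {a m} (proj₂ (a-spec 1≤m)))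

f₁₀ : ∀ m → f 1 (+ 0) m ≡ + (a m + m)
f₁₀ m = trans (ℤ.+-identityʳ _) (cong +_ (cong₂ _+_ (*-identityˡ (a m)) (*-identityˡ m)))

R₁₀-intro : ∀ {m} → 1 ≤ m → R 1 (+ 0) (a m + m)
R₁₀-intro {m} 1≤m = m , 1≤m , f₁₀ m

κ-R₁₀ : ∀ {κ} → IsKappa κ → ∀ {m} → 1 ≤ m → κ (a m + m) ≡ a (a m) + a m
κ-R₁₀ {κ} (_ , κ-R₁₀-clause , _) {m} 1≤m = begin
  κ (a m + m)             ≡⟨ κ-R₁₀-clause (a m + m) (≤-trans 1≤m (m≤n+m m (a m)))
                                             (R₁₀-intro 1≤m) ⟩
  a (a m + m) ∸ 1         ≡⟨ cong (_∸ 1) (a-golden-sum 1≤m) ⟩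
  (a m + m) + a m ∸ 1     ≡⟨ cong (λ t → t + a m ∸ 1) (sym (a∘a 1≤m)) ⟩
  a (a m) + a m           ∎
  where open ≡-Reasoning

iter-a-pos : ∀ i {m} → 1 ≤ m → 1 ≤ iter i a m
iter-a-pos zero 1≤m = 1≤m
iter-a-pos (suc i) 1≤m = a-pos (iter-a-pos i 1≤m)

iter-κ : ∀ {κ} → IsKappa κ → ∀ i {m} → 1 ≤ m → iter i κ (a m + m) ≡ a (iter i a m) + iter i a m
iter-κ K zero 1≤m = refl
iter-κ {κ} K (suc i) 1≤m = trans (cong κ (iter-κ K i 1≤m)) (κ-R₁₀ K (iter-a-pos i 1≤m))

lemma4p6 : (κ : ℕ → ℕ) → IsKappa κ → (n : ℕ) → 1 ≤ n → R 1 (+ 0) n →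
    R 1 (+ 0) (κ n) × iter 3 κ n + 2 ≡ iter 2 κ n + iter 1 κ n
lemma4p6 κ K n _ (m , 1≤m , fm≡n) with ℤ.+-injective (trans (sym (f₁₀ m)) fm≡n)
... | refl = subst (R 1 (+ 0)) (sym (κ-R₁₀ K 1≤m)) (R₁₀-intro (a-pos 1≤m)) , (begin
  iter 3 κ n + 2            ≡⟨ cong (_+ 2) (iter-κ K 3 1≤m) ⟩
  (x 4 + x 3) + 2           ≡⟨ +-suc-suc (x 4) (x 3) ⟩
  suc (x 4) + suc (x 3)     ≡⟨ cong₂ _+_ (a∘a (iter-a-pos 2 1≤m)) (a∘a (iter-a-pos 1 1≤m)) ⟩
  (x 3 + x 2) + (x 2 + x 1) ≡⟨ sym (cong₂ _+_ (iter-κ K 2 1≤m) (iter-κ K 1 1≤m)) ⟩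
  iter 2 κ n + iter 1 κ n   ∎)
  where
  open ≡-Reasoning
  x : ℕ → ℕ
  x i = iter i a m
  +-suc-suc : ∀ p q → p + q + 2 ≡ suc p + suc q
  +-suc-suc = solve-∀
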